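{- Let $X\subseteq\mathbb{N}$. If $X$ contains an arithmetic progression of length $\ell$ but does not contain an arithmetic progression of length $\ell+1$, then the compatibility graph $\mathcal{C}_X$ has a half-induced matching of size $\ell+1$.
   Context: An arithmetic progression of length $\ell$ is a set $\{a,a+d,\dots,a+(\ell-1)d\}$ with $d\ge1$. For $X\subseteq\mathbb{N}$, $\mathcal{C}_X$ is the bipartite graph whose two sides $U,V$ are both copies of $\mathbb{N}$, with $i\in U$ adjacent to $j\in V$ iff $i+j\notin X$. A bipartite graph with sides $U,V$ and edge set $E$ has a half-induced matching of size $\ell$ if there are pairwise distinct $a_1,\dots,a_\ell\in U$ and pairwise distinct $b_1,\dots,b_\ell\in V$ such that $(a_i,b_i)\in E$ for all $i$ and $(a_i,b_j)\notin E$ for all $j>i$. -}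

module Defs where

open import Data.Nat using (ℕ; _+_; _*_; _<_; _≥_)
open import Data.Fin using (Fin; toℕ)
open import Data.Product using (Σ; _×_; ∃; ∃-syntax)
open import Relation.Nullary using (¬_)
open import Function.Definitions using (Injective)
open import Relation.Binary.PropositionalEquality using (_≡_)

Subset : Set₁
Subset = ℕ → Set

ContainsAP : Subset → ℕ → Set
ContainsAP X ℓ = ∃[ a ] ∃[ d ] (d ≥ 1 × ((i : ℕ) → i < ℓ → X (a + i * d)))

-- A bipartite graph with both sides ℕ, given by its edge relation E u v.
BipGraph : Set₁
BipGraph = ℕ → ℕ → Set

CompatGraph : Subset → BipGraph
CompatGraph X i j = ¬ X (i + j)

HasHalfInducedMatching : BipGraph → ℕ → Set
HasHalfInducedMatching E ℓ =
  Σ (Fin ℓ → ℕ) λ a → Σ (Fin ℓ → ℕ) λ b →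
    Injective _≡_ _≡_ a × Injective _≡_ _≡_ b ×
    ((i : Fin ℓ) → E (a i) (b i)) ×
    ((i j : Fin ℓ) → toℕ i < toℕ j → ¬ E (a i) (b j))

{-# OPTIONS --safe #-}
module Submission where

-- Put a i = i d and b j = a + (ℓ - j) d, where a, a + d, …, a + (ℓ-1) d is
-- the progression in X.  Then a i + b j = a + (ℓ + i - j) d: for i < j this
-- is a term of the progression, so (a i, b j) is not an edge, while for i = j
-- it is a + ℓ d, which lies outside X because the progression cannot be
-- extended to length ℓ + 1.

open import Defs
open import Data.Nat using (ℕ; suc; _+_; _*_; _∸_; _<_; _≤_; NonZero; >-nonZero)
open import Data.Nat.Properties
  using (+-cancelˡ-≡; *-cancelʳ-≡; m+[n∸m]≡n; +-monoˡ-<; m<1+n⇒m<n∨m≡n)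
open import Data.Nat.Tactic.RingSolver using (solve-∀)
open import Data.Fin using (Fin; toℕ; opposite)
open import Data.Fin.Properties using (toℕ-injective; toℕ≤pred[n]; opposite-prop; opposite-involutive)
open import Data.Product using (_×_; _,_)
open import Data.Sum using (inj₁; inj₂)
open import Function.Definitions using (Injective)
open import Relation.Nullary using (¬_)
open import Relation.Binary.PropositionalEquality using (_≡_; refl; sym; trans; cong; subst)

extend-<-suc : {P : ℕ → Set} {ℓ : ℕ} →
  (∀ i → i < ℓ → P i) → P ℓ → ∀ i → i < suc ℓ → P i
extend-<-suc below last i i<1+ℓ with m<1+n⇒m<n∨m≡n i<1+ℓ
... | inj₁ i<ℓ = below i i<ℓ
... | inj₂ refl = last

nextTerm∉ : (X : Subset) {ℓ a d : ℕ} → 1 ≤ d → ¬ ContainsAP X (suc ℓ) →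
  (∀ i → i < ℓ → X (a + i * d)) → ¬ X (a + ℓ * d)
nextTerm∉ X {a = a} {d} 1≤d noAP ap last = noAP (a , d , 1≤d , extend-<-suc ap last)

m<n≤o⇒m+[o∸n]<o : ∀ {m n o} → m < n → n ≤ o → m + (o ∸ n) < o
m<n≤o⇒m+[o∸n]<o {m} {n} {o} m<n n≤o =
  subst (m + (o ∸ n) <_) (m+[n∸m]≡n n≤o) (+-monoˡ-< (o ∸ n) m<n)

opposite-injective : ∀ {n} → Injective _≡_ _≡_ (opposite {n})
opposite-injective {x = i} {y = j} eq =
  trans (sym (opposite-involutive i)) (trans (cong opposite eq) (opposite-involutive j))

progression-shift : ∀ a d m k → m * d + (a + k * d) ≡ a + (m + k) * d
progression-shift = solve-∀

module _ (a d : ℕ) .{{_ : NonZero d}} where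

  progression-injective : Injective _≡_ _≡_ (λ i → a + i * d)
  progression-injective {i} {j} eq = *-cancelʳ-≡ i j d (+-cancelˡ-≡ a (i * d) (j * d) eq)

  module _ {ℓ : ℕ} where

    matchLeft matchRight : Fin (suc ℓ) → ℕ
    matchLeft i = toℕ i * d
    matchRight j = a + toℕ (opposite j) * d

    matchLeft-injective : Injective _≡_ _≡_ matchLeft
    matchLeft-injective eq = toℕ-injective (*-cancelʳ-≡ _ _ d eq)

    matchRight-injective : Injective _≡_ _≡_ matchRight
    matchRight-injective eq = opposite-injective (toℕ-injective (progression-injective eq))

    matchLeft+matchRight : ∀ i j → matchLeft i + matchRight j ≡ a + (toℕ i + (ℓ ∸ toℕ j)) * d
    matchLeft+matchRight i j rewrite opposite-prop j = progression-shift a d (toℕ i) (ℓ ∸ toℕ j)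

lemma4p2 : (X : Subset) (ℓ : ℕ) →
    ContainsAP X ℓ × ¬ ContainsAP X (suc ℓ) →
    HasHalfInducedMatching (CompatGraph X) (suc ℓ)
lemma4p2 X ℓ ((a , d , 1≤d , ap) , noAP) =
  matchLeft a d , matchRight a d , matchLeft-injective a d , matchRight-injective a d , edge , nonEdge
  where
  instance
    d≢0 : NonZero d
    d≢0 = >-nonZero 1≤d

  edge : ∀ i → CompatGraph X (matchLeft a d i) (matchRight a d i)
  edge i rewrite matchLeft+matchRight a d i i | m+[n∸m]≡n (toℕ≤pred[n] i) = nextTerm∉ X 1≤d noAP ap

  nonEdge : ∀ i j → toℕ i < toℕ j → ¬ CompatGraph X (matchLeft a d i) (matchRight a d j)
  nonEdge i j i<j ∉X rewrite matchLeft+matchRight a d i j =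
    ∉X (ap _ (m<n≤o⇒m+[o∸n]<o i<j (toℕ≤pred[n] j)))
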